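{- The representable sheaf $\mathbf y_{\mathbf N}$ is not a natural numbers object in $\mathrm{PSh}(\mathrm{R})$, nor in $\mathcal{R}$.
   Context: The category $\mathrm{R}$ has two objects $\mathbf 1$ (terminal) and $\mathbf N$, with $\mathrm{R}(\mathbf N,\mathbf N)$ the set of primitive recursive functions $\mathbb N\to\mathbb N$ (composition is composition of functions) and $\mathrm{R}(\mathbf 1,\mathbf N)=\mathbb N$ (elements of $\mathbb N$, composed with $\mathbf N\to\mathbf N$ by evaluation). $\mathrm{J}_{\mathrm{fin}}$ is the Grothendieck topology on $\mathrm{R}$ generated by the finite families $\{f_i:\mathbf N^{n_i}\to\mathbf N\}$ with $n_i\in\{0,1\}$, $\mathbf N^0=\mathbf 1$, that are jointly surjective as maps of sets. $\mathcal R=\mathrm{Sh}(\mathrm{R},\mathrm{J}_{\mathrm{fin}})$; $\mathrm{J}_{\mathrm{fin}}$ is subcanonical so $\mathbf y_{\mathbf N}$ is a sheaf, with zero given by $0\in\mathbb N$ and successor given by the primitive recursive successor function. -}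

module Defs where

open import Data.Nat using (ℕ; zero; suc)
open import Data.Fin using (Fin)
import Data.Fin as F
open import Data.Vec using (Vec; []; _∷_; lookup)
open import Data.Unit using (⊤; tt)
open import Data.Product using (Σ; ∃; _×_; _,_; proj₁; proj₂)
open import Relation.Binary.Bundles using (Setoid)
open import Relation.Binary.PropositionalEquality using (_≡_; refl; cong; trans; sym)
open import Level using (0ℓ) renaming (suc to lsuc)

data PR : ℕ → Set where
  zeroᵖ : ∀ {n} → PR n
  succᵖ : PR 1
  projᵖ : ∀ {n} → Fin n → PR n
  compᵖ : ∀ {m n} → PR m → Vec (PR n) m → PR n
  recᵖ  : ∀ {n} → PR n → PR (suc (suc n)) → PR (suc n)

mutual
  ⟦_⟧ : ∀ {n} → PR n → Vec ℕ n → ℕ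
  ⟦ zeroᵖ ⟧ xs = 0
  ⟦ succᵖ ⟧ (x ∷ []) = suc x
  ⟦ projᵖ i ⟧ xs = lookup xs i
  ⟦ compᵖ f gs ⟧ xs = ⟦ f ⟧ (⟦ gs ⟧* xs)
  ⟦ recᵖ f g ⟧ (zero ∷ xs) = ⟦ f ⟧ xs
  ⟦ recᵖ f g ⟧ (suc k ∷ xs) = ⟦ g ⟧ (k ∷ ⟦ recᵖ f g ⟧ (k ∷ xs) ∷ xs)

  ⟦_⟧* : ∀ {m n} → Vec (PR n) m → Vec ℕ n → Vec ℕ m
  ⟦ [] ⟧* xs = []
  ⟦ g ∷ gs ⟧* xs = ⟦ g ⟧ xs ∷ ⟦ gs ⟧* xs

IsPR : (ℕ → ℕ) → Set
IsPR f = Σ (PR 1) λ c → ∀ x → ⟦ c ⟧ (x ∷ []) ≡ f x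

constPR : ℕ → PR 1
constPR zero = zeroᵖ
constPR (suc n) = compᵖ succᵖ (constPR n ∷ [])

constPR-sem : ∀ n x → ⟦ constPR n ⟧ (x ∷ []) ≡ n
constPR-sem zero x = refl
constPR-sem (suc n) x = cong suc (constPR-sem n x)

data Ob : Set where
  𝟙 𝐍 : Ob

El : Ob → Set
El 𝟙 = ⊤
El 𝐍 = ℕ

IsMor : (a b : Ob) → (El a → El b) → Set
IsMor 𝐍 𝐍 f = IsPR f
IsMor _ _ f = ⊤

-- R(a,b): maps of sets El a → El b, primitive recursive when a = b = 𝐍
Hom : Ob → Ob → Set
Hom a b = Σ (El a → El b) (IsMor a b)

_≈ₕ_ : ∀ {a b} → Hom a b → Hom a b → Set
f ≈ₕ g = ∀ x → proj₁ f x ≡ proj₁ g x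

idₕ : ∀ a → Hom a a
idₕ 𝟙 = (λ x → x) , tt
idₕ 𝐍 = (λ x → x) , (projᵖ F.zero , λ x → refl)

∘-mor : ∀ a b c (g : El b → El c) (f : El a → El b) →
        IsMor b c g → IsMor a b f → IsMor a c (λ x → g (f x))
∘-mor 𝟙 b 𝟙 g f _ _ = tt
∘-mor 𝟙 b 𝐍 g f _ _ = tt
∘-mor 𝐍 b 𝟙 g f _ _ = tt
∘-mor 𝐍 𝟙 𝐍 g f _ _ = constPR (g tt) , λ x → constPR-sem (g tt) x
∘-mor 𝐍 𝐍 𝐍 g f (cg , pg) (cf , pf) =
  compᵖ cg (cf ∷ []) , λ x → trans (cong (λ y → ⟦ cg ⟧ (y ∷ [])) (pf x)) (pg (f x))

_∘ₕ_ : ∀ {a b c} → Hom b c → Hom a b → Hom a c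
_∘ₕ_ {a} {b} {c} (g , pg) (f , pf) = (λ x → g (f x)) , ∘-mor a b c g f pg pf

!ₕ : ∀ a → Hom a 𝟙
!ₕ a = (λ _ → tt) , ∘-mor-helper a
  where
  ∘-mor-helper : ∀ a → IsMor a 𝟙 (λ _ → tt)
  ∘-mor-helper 𝟙 = tt
  ∘-mor-helper 𝐍 = tt

zeroₕ : Hom 𝟙 𝐍
zeroₕ = (λ _ → 0) , tt

succₕ : Hom 𝐍 𝐍
succₕ = suc , (succᵖ , λ x → refl)

record PSh : Set₁ where
  field
    F       : Ob → Setoid 0ℓ 0ℓ
  open module S (a : Ob) = Setoid (F a) using (Carrier; _≈_)
  field
    act     : ∀ {a b} → Hom a b → Carrier b → Carrier a
    act-cong : ∀ {a b} (f : Hom a b) {x y : Carrier b} →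
               _≈_ b x y → _≈_ a (act f x) (act f y)
    act-resp : ∀ {a b} {f g : Hom a b} → f ≈ₕ g →
               ∀ x → _≈_ a (act f x) (act g x)
    act-id  : ∀ {a} x → _≈_ a (act (idₕ a) x) x
    act-∘   : ∀ {a b c} (g : Hom b c) (f : Hom a b) x →
               _≈_ a (act (g ∘ₕ f) x) (act f (act g x))

open PSh public using (F; act)

Obj : PSh → Ob → Set
Obj P a = Setoid.Carrier (PSh.F P a)

Eq : (P : PSh) (a : Ob) → Obj P a → Obj P a → Set
Eq P a = Setoid._≈_ (PSh.F P a)

record _⇒_ (P Q : PSh) : Set where
  field
    η    : ∀ a → Obj P a → Obj Q a
    ηcong : ∀ a {x y} → Eq P a x y → Eq Q a (η a x) (η a y)
    nat  : ∀ {a b} (f : Hom a b) (x : Obj P b) →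
           Eq Q a (η a (act P f x)) (act Q f (η b x))

open _⇒_ public

_≈ⁿ_ : ∀ {P Q} → P ⇒ Q → P ⇒ Q → Set
_≈ⁿ_ {P} {Q} α β = ∀ a (x : Obj P a) → Eq Q a (η α a x) (η β a x)

_∘ⁿ_ : ∀ {P Q S} → Q ⇒ S → P ⇒ Q → P ⇒ S
_∘ⁿ_ {P} {Q} {S} β α = record
  { η = λ a x → η β a (η α a x)
  ; ηcong = λ a e → _⇒_.ηcong β a (_⇒_.ηcong α a e)
  ; nat = λ {a} {b} f x →
      Setoid.trans (F S a) (_⇒_.ηcong β a (nat α f x)) (nat β f (η α b x))
  }

⊤ₛ : Setoid 0ℓ 0ℓ
⊤ₛ = record { Carrier = ⊤ ; _≈_ = λ _ _ → ⊤
            ; isEquivalence = record { refl = tt ; sym = λ _ → tt ; trans = λ _ _ → tt } }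

𝟏 : PSh
𝟏 = record
  { F = λ _ → ⊤ₛ ; act = λ _ _ → tt ; act-cong = λ _ _ → tt
  ; act-resp = λ _ _ → tt ; act-id = λ _ → tt ; act-∘ = λ _ _ _ → tt }

homₛ : Ob → Setoid 0ℓ 0ℓ
homₛ a = record
  { Carrier = Hom a 𝐍 ; _≈_ = _≈ₕ_
  ; isEquivalence = record { refl = λ x → refl ; sym = λ p x → sym (p x)
                           ; trans = λ p q x → trans (p x) (q x) } }

y𝐍 : PSh
y𝐍 = record
  { F = homₛ
  ; act = λ f g → g ∘ₕ f
  ; act-cong = λ f e x → e (proj₁ f x)
  ; act-resp = λ {a} {b} {f} {g} e h x → cong (proj₁ h) (e x)
  ; act-id = λ {a} → y-id a
  ; act-∘ = λ g f h x → refl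
  }
  where
  y-id : ∀ a (h : Hom a 𝐍) → (h ∘ₕ idₕ a) ≈ₕ h
  y-id 𝟙 h x = refl
  y-id 𝐍 h x = refl

zeroⁿ : 𝟏 ⇒ y𝐍
zeroⁿ = record
  { η = λ a _ → zeroₕ ∘ₕ !ₕ a
  ; ηcong = λ a _ x → refl
  ; nat = λ f x y → refl }

succⁿ : y𝐍 ⇒ y𝐍
succⁿ = record
  { η = λ a g → succₕ ∘ₕ g
  ; ηcong = λ a e x → cong suc (e x)
  ; nat = λ f g x → refl }

-- (N, z, s) has the NNO universal property with respect to all objects X
-- satisfying the predicate C (C = everything: PSh(R); C = IsSheaf: 𝓡).
IsNNOAmong : (C : PSh → Set) (N : PSh) → 𝟏 ⇒ N → N ⇒ N → Set₁
IsNNOAmong C N z s =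
  (X : PSh) → C X → (x : 𝟏 ⇒ X) (t : X ⇒ X) →
  Σ (N ⇒ X) λ h →
    ((h ∘ⁿ z) ≈ⁿ x × (h ∘ⁿ s) ≈ⁿ (t ∘ⁿ h)) ×
    ((h' : N ⇒ X) → (h' ∘ⁿ z) ≈ⁿ x → (h' ∘ⁿ s) ≈ⁿ (t ∘ⁿ h') → h' ≈ⁿ h)

AnyPSh : PSh → Set
AnyPSh _ = ⊤

IsNNOinPSh : (N : PSh) → 𝟏 ⇒ N → N ⇒ N → Set₁
IsNNOinPSh = IsNNOAmong AnyPSh

-- a generating J_fin-cover of 𝐍: a finite family f_i : dom i → 𝐍,
-- dom i ∈ {𝟙 = 𝐍⁰, 𝐍 = 𝐍¹}, jointly surjective as maps of sets
record FinCover : Set where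
  field
    size : ℕ
    dom  : Fin size → Ob
    map  : (i : Fin size) → Hom (dom i) 𝐍
    surj : ∀ (y : ℕ) → Σ (Fin size) λ i → Σ (El (dom i)) λ x → proj₁ (map i) x ≡ y

-- sheaf condition for every generating cover (J_fin is generated by a coverage)
IsSheaf : PSh → Set
IsSheaf P = (U : FinCover) → let open FinCover U in
  (x : (i : Fin size) → Obj P (dom i)) →
  (∀ i j c (g : Hom c (dom i)) (h : Hom c (dom j)) →
     (map i ∘ₕ g) ≈ₕ (map j ∘ₕ h) → Eq P c (act P g (x i)) (act P h (x j))) →
  Σ (Obj P 𝐍) λ a →
    (∀ i → Eq P (dom i) (act P (map i) a) (x i)) ×
    ((b : Obj P 𝐍) → (∀ i → Eq P (dom i) (act P (map i) b) (x i)) → Eq P 𝐍 b a)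

IsNNOin𝓡 : (N : PSh) → 𝟏 ⇒ N → N ⇒ N → Set₁
IsNNOin𝓡 = IsNNOAmong IsSheaf

{-# OPTIONS --safe #-}
module Submission where

open import Defs
open import Relation.Nullary using (¬_)
open import Data.Nat using (ℕ; zero; suc; _≤_; z≤n; s≤s)
open import Data.Nat.GeneralisedArithmetic using (fold)
open import Data.Nat.Properties using (≤-trans; 1+n≰n)
open import Data.Fin using (Fin)
open import Data.List using (tabulate)
open import Data.List.Extrema.Nat using (max; xs≤max)
open import Data.List.Relation.Unary.All.Properties using (tabulate⁻)
open import Data.Unit using (tt)
open import Data.Product using (_×_; ∃; _,_; proj₁; proj₂)
open import Relation.Binary.Bundles using (Setoid)
open import Relation.Binary.PropositionalEquality using (_≡_; refl; sym; trans; cong; subst)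
open import Level using (0ℓ)

-- By the Yoneda lemma a map h : y𝐍 ⇒ X is determined by its
-- generic element h(id) ∈ X(𝐍), and h(n) ∈ X(𝟙) is the restriction of h(id)
-- along the point n. Take for X(a) the bounded functions El a → ℕ, with zero
-- and successor acting pointwise; it is a J_fin-sheaf because covers are
-- finite, so finitely many bounds suffice for a glued function. A recursor
-- h would satisfy h(n)(tt) = n for every n, while h(n)(tt) = h(id)(n) is
-- bounded by the bound of h(id).

pointₕ : ∀ {a} → El a → Hom 𝟙 a
pointₕ u = (λ _ → u) , tt

common-bound : ∀ {n} (B : Fin n → ℕ) → ∃ λ M → ∀ i → B i ≤ M
common-bound B = max 0 (tabulate B) , tabulate⁻ (xs≤max 0 (tabulate B))

record Bounded (A : Set) : Set where
  constructor bounded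
  field
    fun       : A → ℕ
    bound     : ℕ
    fun≤bound : ∀ x → fun x ≤ bound

open Bounded

precompose : ∀ {A B : Set} → (A → B) → Bounded B → Bounded A
precompose f (bounded g B g≤B) = bounded (λ x → g (f x)) B (λ x → g≤B (f x))

Boundedₛ : Set → Setoid 0ℓ 0ℓ
Boundedₛ A = record
  { Carrier = Bounded A
  ; _≈_ = λ u v → ∀ x → fun u x ≡ fun v x
  ; isEquivalence = record { refl = λ x → refl ; sym = λ p x → sym (p x)
                           ; trans = λ p q x → trans (p x) (q x) } }

BoundedFn : PSh
BoundedFn = record
  { F = λ a → Boundedₛ (El a)
  ; act = λ f → precompose (proj₁ f)
  ; act-cong = λ f e x → e (proj₁ f x)
  ; act-resp = λ e u x → cong (fun u) (e x)
  ; act-id = λ {a} → act-id a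
  ; act-∘ = λ g f u x → refl
  }
  where
  act-id : ∀ a (u : Bounded (El a)) x → fun (precompose (proj₁ (idₕ a)) u) x ≡ fun u x
  act-id 𝟙 u x = refl
  act-id 𝐍 u x = refl

zeroᵇ : 𝟏 ⇒ BoundedFn
zeroᵇ = record
  { η = λ a _ → bounded (λ _ → 0) 0 (λ _ → z≤n)
  ; ηcong = λ a _ x → refl
  ; nat = λ f _ x → refl }

sucᵇ : BoundedFn ⇒ BoundedFn
sucᵇ = record
  { η = λ a u → bounded (λ x → suc (fun u x)) (suc (bound u)) (λ x → s≤s (fun≤bound u x))
  ; ηcong = λ a e x → cong suc (e x)
  ; nat = λ f u x → refl }

module _ (U : FinCover) (x : (i : Fin (FinCover.size U)) → Bounded (El (FinCover.dom U i))) where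
  open FinCover U

  Compatible : Set
  Compatible = ∀ i j c (g : Hom c (dom i)) (h : Hom c (dom j)) →
    (map i ∘ₕ g) ≈ₕ (map j ∘ₕ h) → Eq BoundedFn c (act BoundedFn g (x i)) (act BoundedFn h (x j))

  compatible⇒agree : Compatible → ∀ i j (u : El (dom i)) (v : El (dom j)) →
                     proj₁ (map i) u ≡ proj₁ (map j) v → fun (x i) u ≡ fun (x j) v
  compatible⇒agree compat i j u v e = compat i j 𝟙 (pointₕ u) (pointₕ v) (λ _ → e) tt

  glue : Bounded ℕ
  glue = bounded value (proj₁ bounds) value≤bound
    where
    bounds : ∃ λ M → ∀ i → bound (x i) ≤ M
    bounds = common-bound (λ i → bound (x i))
    value : ℕ → ℕ
    value y = let (i , u , _) = surj y in fun (x i) u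
    value≤bound : ∀ y → value y ≤ proj₁ bounds
    value≤bound y = let (i , u , _) = surj y in ≤-trans (fun≤bound (x i) u) (proj₂ bounds i)

  glue-restricts : Compatible → ∀ i u → fun glue (proj₁ (map i) u) ≡ fun (x i) u
  glue-restricts compat i u =
    let (j , v , e) = surj (proj₁ (map i) u) in compatible⇒agree compat j i v u e

  glue-unique : (b : Bounded ℕ) → (∀ i u → fun b (proj₁ (map i) u) ≡ fun (x i) u) →
                ∀ y → fun b y ≡ fun glue y
  glue-unique b restricts y =
    let (j , v , e) = surj y in trans (cong (fun b) (sym e)) (restricts j v)

BoundedFn-isSheaf : IsSheaf BoundedFn
BoundedFn-isSheaf U x compat =
  glue U x , glue-restricts U x compat , glue-unique U x

recursor-on-points : ∀ {X} (x : 𝟏 ⇒ X) (t : X ⇒ X) (h : y𝐍 ⇒ X) →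
  (h ∘ⁿ zeroⁿ) ≈ⁿ x → (h ∘ⁿ succⁿ) ≈ⁿ (t ∘ⁿ h) →
  ∀ n → Eq X 𝟙 (η h 𝟙 (pointₕ n)) (fold (η x 𝟙 tt) (η t 𝟙) n)
recursor-on-points x t h hz hs zero = hz 𝟙 tt
recursor-on-points {X} x t h hz hs (suc n) =
  Setoid.trans (F X 𝟙) (hs 𝟙 (pointₕ n)) (ηcong t 𝟙 (recursor-on-points x t h hz hs n))

fold-sucᵇ : ∀ n → fun (fold (η zeroᵇ 𝟙 tt) (η sucᵇ 𝟙) n) tt ≡ n
fold-sucᵇ zero = refl
fold-sucᵇ (suc n) = cong suc (fold-sucᵇ n)

bounded-on-points : (h : y𝐍 ⇒ BoundedFn) →
  ∀ n → fun (η h 𝟙 (pointₕ n)) tt ≤ bound (η h 𝐍 (idₕ 𝐍))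
bounded-on-points h n =
  subst (_≤ bound (η h 𝐍 (idₕ 𝐍))) (sym (nat h (pointₕ n) (idₕ 𝐍) tt)) (fun≤bound (η h 𝐍 (idₕ 𝐍)) n)

no-recursor-into-BoundedFn : (h : y𝐍 ⇒ BoundedFn) →
  ¬ ((h ∘ⁿ zeroⁿ) ≈ⁿ zeroᵇ × (h ∘ⁿ succⁿ) ≈ⁿ (sucᵇ ∘ⁿ h))
no-recursor-into-BoundedFn h (hz , hs) =
  1+n≰n (subst (_≤ B) (trans (recursor-on-points zeroᵇ sucᵇ h hz hs (suc B) tt) (fold-sucᵇ (suc B)))
                      (bounded-on-points h (suc B)))
  where
  B : ℕ
  B = bound (η h 𝐍 (idₕ 𝐍))

y𝐍-not-NNOAmong : ∀ {C} → C BoundedFn → ¬ IsNNOAmong C y𝐍 zeroⁿ succⁿ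
y𝐍-not-NNOAmong C-BoundedFn nno =
  let (h , recursion , _) = nno BoundedFn C-BoundedFn zeroᵇ sucᵇ
  in no-recursor-into-BoundedFn h recursion

mainTheorem6 : ¬ IsNNOinPSh y𝐍 zeroⁿ succⁿ × ¬ IsNNOin𝓡 y𝐍 zeroⁿ succⁿ
mainTheorem6 = y𝐍-not-NNOAmong tt , y𝐍-not-NNOAmong BoundedFn-isSheaf
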